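{- Let $n\ge3$, $k\ge0$, let $R$ be a maximal reversible set in $G_n^k$ (so that $|A(R)|=k+1$), and let $x_1,\dots,x_{k+1}$ be a consistent labeling of $A(R)$. Then for each $i\in\{1,\dots,k+1\}$, $|B(x_i,R)|\le k+2-i$.
   Context: The crown $S_n^k$ is the height-2 poset on $A\cup B$, $A=\{a_1,\dots,a_{n+k}\}$ minimal elements, $B=\{b_1,\dots,b_{n+k}\}$ maximal elements, indices cyclic mod $n+k$; $a_i$ is incomparable to $b_j$ iff $j\in\{i,\dots,i+k\}$ (mod $n+k$), otherwise $a_i<b_j$. $\mathrm{Inc}(A,B)$ is the set of incomparable pairs $(a,b)\in A\times B$; $G_n^k$ is the graph on $\mathrm{Inc}(A,B)$ with $(a,b)\sim(x,y)$ iff $a<y$ and $x<b$. A set $R\subseteq\mathrm{Inc}(A,B)$ is reversible if some linear extension $L$ of $S_n^k$ has $x>y$ in $L$ for all $(x,y)\in R$; maximal reversible means reversible and not properly contained in a reversible set. For $R\subseteq\mathrm{Inc}(A,B)$, $A(R)=\{a\in A: (a,b)\in R\text{ for some }b\}$ and $B(a,R)=\{b\in B:(a,b)\in R\}$. For a reversible $R$ the sets $B(a,R)$, $a\in A(R)$, are totally ordered by inclusion; a labeling $x_1,\dots,x_{k+1}$ of $A(R)$ is consistent if $B(x_\beta,R)\subseteq B(x_\alpha,R)$ whenever $\alpha<\beta$. -}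

module Defs where

open import Level using (0ℓ)
open import Data.Nat using (ℕ; _+_; _≤_; _∸_)
open import Data.Fin using (Fin; toℕ; _<_)
open import Data.Fin.Subset using (Subset; _∈_; _⊆_; ∣_∣)
open import Data.Sum using (_⊎_; inj₁; inj₂)
open import Data.Product using (Σ; ∃; _×_)
open import Relation.Nullary using (¬_)
open import Relation.Binary.Core using (Rel)
open import Relation.Binary.Structures using (IsStrictTotalOrder)
open import Relation.Binary.PropositionalEquality using (_≡_)
open import Function.Definitions using (Injective)

-- Crown S_n^k.  Indices of a_i, b_j are Fin (n + k) (0-based, cyclic mod n+k).
-- Elements of the poset: inj₁ i = a_i (minimal), inj₂ j = b_j (maximal).
Elem : ℕ → ℕ → Set
Elem n k = Fin (n + k) ⊎ Fin (n + k)

-- a_i incomparable to b_j  iff  j ∈ {i, i+1, ..., i+k} (mod n+k),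
-- i.e. j ≡ i + d (mod n+k) for some 0 ≤ d ≤ k.  Since i < n+k and
-- d ≤ k < n+k (when n ≥ 1), i + d < 2(n+k), so the reduction mod n+k
-- is either nothing or subtracting n+k once.
Incomp : (n k : ℕ) → Fin (n + k) → Fin (n + k) → Set
Incomp n k i j =
  Σ ℕ λ d → d ≤ k × ((toℕ i + d ≡ toℕ j) ⊎ (toℕ i + d ≡ toℕ j + (n + k)))

data CrownLt (n k : ℕ) : Elem n k → Elem n k → Set where
  a<b : ∀ {i j} → ¬ Incomp n k i j → CrownLt n k (inj₁ i) (inj₂ j)

record LinearExtension (n k : ℕ) : Set₁ where
  field
    _<L_    : Rel (Elem n k) 0ℓ
    isSTO   : IsStrictTotalOrder _≡_ _<L_
    extends : ∀ p q → CrownLt n k p q → p <L q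

-- A subset R of A × B, given by R a = B(a,R) = { b : (a,b) ∈ R }.
PairSet : ℕ → Set
PairSet m = Fin m → Subset m

InInc : (n k : ℕ) → PairSet (n + k) → Set
InInc n k R = ∀ a b → b ∈ R a → Incomp n k a b

_⊆R_ : ∀ {m} → PairSet m → PairSet m → Set
R ⊆R R' = ∀ a → R a ⊆ R' a

Reversible : (n k : ℕ) → PairSet (n + k) → Set₁
Reversible n k R =
  InInc n k R ×
  Σ (LinearExtension n k) λ L →
    ∀ a b → b ∈ R a → LinearExtension._<L_ L (inj₂ b) (inj₁ a)

MaximalReversible : (n k : ℕ) → PairSet (n + k) → Set₁
MaximalReversible n k R =
  Reversible n k R ×
  (∀ R' → Reversible n k R' → R ⊆R R' → R' ⊆R R)

InA : ∀ {m} → PairSet m → Fin m → Set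
InA R a = ∃ λ b → b ∈ R a

-- x : Fin (k+1) → A is a labeling x_1,...,x_{k+1} of A(R)
-- (0-based: x α is x_{α+1}): injective, with image exactly A(R).
Labeling : ∀ {m} (k : ℕ) → PairSet m → (Fin (Data.Nat.suc k) → Fin m) → Set
Labeling k R x = Injective _≡_ _≡_ x × (∀ a → InA R a → ∃ λ α → x α ≡ a)
                 × (∀ α → InA R (x α))

Consistent : ∀ {m} (k : ℕ) → PairSet m → (Fin (Data.Nat.suc k) → Fin m) → Set
Consistent k R x = ∀ α β → α < β → R (x β) ⊆ R (x α)

-- For j ≤ i, consistency gives B(x_i,R) ⊆ B(x_j,R) ⊆ Inc(A,B), so B(x_i,R) lies in each of the
-- i cyclic windows {x_j, …, x_j + k} of k + 1 consecutive indices mod n + k. Given b ∈ B(x_i,R),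
-- let s be the x_j closest behind b. Every t ∈ B(x_i,R) lies at a distance d ≤ k ahead of s; each
-- other x_j lies δ_j > 0 steps behind s, the δ_j distinct, and d ≠ k + 1 − δ_j, as otherwise t would
-- lie k + 1 steps ahead of x_j, which for n ≥ 2 is outside its window. So the distances from s to
-- B(x_i,R) and the i − 1 values k + 1 − δ_j are distinct elements of {0, …, k}. Only R ⊆ Inc(A,B)
-- and the consistency of the labeling are used.
module Submission where

open import Defs
open import Data.Nat
open import Data.Nat.Properties
open import Data.Nat.DivMod using (_%_; _/_; m%n<n; m≡m%n+[m/n]*n; [m+kn]%n≡m%n; m<n⇒m%n≡m)
open import Algebra.Properties.CommutativeSemigroup +-commutativeSemigroup using (x∙yz≈y∙xz; xy∙z≈xz∙y)
open import Data.Fin as Fin using (Fin; toℕ; fromℕ<; splitAt; punchIn; inject≤)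
open import Data.Fin.Properties as Finₚ
  using (injective⇒≤; toℕ-fromℕ<; toℕ<n; toℕ-injective; toℕ-inject≤; inject≤-injective;
         punchIn-injective; punchInᵢ≢i; +↔⊎)
open import Data.Fin.Subset using (Subset; _∈_; _⊆_; ∣_∣; inside; outside; Nonempty)
open import Data.Fin.Subset.Properties using (nonempty?; Empty-unique; ∣⊥∣≡0)
open import Data.List using (allFin)
open import Data.List.Extrema.Nat using (argmin; f[argmin]≤f[xs])
open import Data.List.Membership.Propositional.Properties using (∈-allFin)
import Data.List.Relation.Unary.All as All
open import Data.Vec using (_∷_; here; there)
open import Data.Sum using (_⊎_; inj₁; inj₂; [_,_])
open import Data.Product using (∃; ∃₂; _,_; _×_; proj₁; proj₂)
open import Function using (_∘_)
open import Function.Bundles using (Injection)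
open import Function.Properties.Inverse using (↔⇒↣)
open import Function.Definitions using (Injective)
open import Relation.Binary.PropositionalEquality using (_≡_; _≢_; refl; sym; trans; cong; subst; module ≡-Reasoning)
open import Relation.Nullary using (yes; no; contradiction)

infix 4 _≡_[mod_]
_≡_[mod_] : ℕ → ℕ → ℕ → Set
x ≡ y [mod N ] = ∃₂ λ q r → x + q * N ≡ y + r * N

module _ {N : ℕ} where
  open ≡-Reasoning

  ≡⇒≡-mod : ∀ {x y} → x ≡ y → x ≡ y [mod N ]
  ≡⇒≡-mod x≡y = 0 , 0 , cong (_+ 0) x≡y

  ≡-mod-sym : ∀ {x y} → x ≡ y [mod N ] → y ≡ x [mod N ]
  ≡-mod-sym (q , r , e) = r , q , sym e

  ≡-mod-trans : ∀ {x y z} → x ≡ y [mod N ] → y ≡ z [mod N ] → x ≡ z [mod N ]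
  ≡-mod-trans {x} {y} {z} (q , r , e) (q′ , r′ , e′) = q + q′ , r′ + r , (begin
    x + (q + q′) * N       ≡⟨ cong (x +_) (*-distribʳ-+ N q q′) ⟩
    x + (q * N + q′ * N)   ≡⟨ +-assoc x _ _ ⟨
    (x + q * N) + q′ * N   ≡⟨ cong (_+ q′ * N) e ⟩
    (y + r * N) + q′ * N   ≡⟨ xy∙z≈xz∙y y _ _ ⟩
    (y + q′ * N) + r * N   ≡⟨ cong (_+ r * N) e′ ⟩
    (z + r′ * N) + r * N   ≡⟨ +-assoc z _ _ ⟩
    z + (r′ * N + r * N)   ≡⟨ cong (z +_) (*-distribʳ-+ N r′ r) ⟨
    z + (r′ + r) * N       ∎)

  ≡-mod-+ʳ : ∀ {x y} z → x ≡ y [mod N ] → x + z ≡ y + z [mod N ]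
  ≡-mod-+ʳ {x} {y} z (q , r , e) = q , r , (begin
    x + z + q * N ≡⟨ xy∙z≈xz∙y x z _ ⟩
    x + q * N + z ≡⟨ cong (_+ z) e ⟩
    y + r * N + z ≡⟨ xy∙z≈xz∙y y _ z ⟩
    y + z + r * N ∎)

  ≡-mod-cancelˡ : ∀ a {x y} → a + x ≡ a + y [mod N ] → x ≡ y [mod N ]
  ≡-mod-cancelˡ a {x} {y} (q , r , e) = q , r , +-cancelˡ-≡ a _ _ (begin
    a + (x + q * N) ≡⟨ +-assoc a x _ ⟨
    a + x + q * N   ≡⟨ e ⟩
    a + y + r * N   ≡⟨ +-assoc a y _ ⟩
    a + (y + r * N) ∎)

  ≡-mod-cancelʳ : ∀ a {x y} → x + a ≡ y + a [mod N ] → x ≡ y [mod N ]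
  ≡-mod-cancelʳ a {x} {y} x+a≡y+a = ≡-mod-cancelˡ a
    (≡-mod-trans (≡⇒≡-mod (+-comm a x)) (≡-mod-trans x+a≡y+a (≡⇒≡-mod (+-comm y a))))

  ≡-mod⇒≡ : ∀ {x y} → x < N → y < N → x ≡ y [mod N ] → x ≡ y
  ≡-mod⇒≡ {x} {y} x<N y<N (q , r , e) = begin
    x               ≡⟨ m<n⇒m%n≡m x<N ⟨
    x % N           ≡⟨ [m+kn]%n≡m%n x q N ⟨
    (x + q * N) % N ≡⟨ cong (_% N) e ⟩
    (y + r * N) % N ≡⟨ [m+kn]%n≡m%n y r N ⟩
    y % N           ≡⟨ m<n⇒m%n≡m y<N ⟩
    y               ∎
    where instance _ = >-nonZero (≤-<-trans z≤n x<N)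

module _ {N : ℕ} .{{_ : NonZero N}} where
  open ≡-Reasoning

  dist : Fin N → Fin N → ℕ
  dist a t = (toℕ t + (N ∸ toℕ a)) % N

  dist<N : ∀ a t → dist a t < N
  dist<N a t = m%n<n _ N

  a+dist≡t : ∀ a t → toℕ a + dist a t ≡ toℕ t [mod N ]
  a+dist≡t a t = u / N , 1 , (begin
    toℕ a + u % N + (u / N) * N   ≡⟨ +-assoc (toℕ a) _ _ ⟩
    toℕ a + (u % N + (u / N) * N) ≡⟨ cong (toℕ a +_) (m≡m%n+[m/n]*n u N) ⟨
    toℕ a + (toℕ t + (N ∸ toℕ a)) ≡⟨ x∙yz≈y∙xz (toℕ a) (toℕ t) _ ⟩
    toℕ t + (toℕ a + (N ∸ toℕ a)) ≡⟨ cong (toℕ t +_) (m+[n∸m]≡n (<⇒≤ (toℕ<n a))) ⟩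
    toℕ t + N                     ≡⟨ cong (toℕ t +_) (*-identityˡ N) ⟨
    toℕ t + 1 * N                 ∎)
    where u = toℕ t + (N ∸ toℕ a)

  dist-unique : ∀ {a t d} → d < N → toℕ a + d ≡ toℕ t [mod N ] → dist a t ≡ d
  dist-unique {a} {t} d<N a+d≡t = ≡-mod⇒≡ (dist<N a t) d<N
    (≡-mod-cancelˡ (toℕ a) (≡-mod-trans (a+dist≡t a t) (≡-mod-sym a+d≡t)))

  dist-injectiveˡ : ∀ t → Injective _≡_ _≡_ (λ a → dist a t)
  dist-injectiveˡ t {a} {a′} eq = toℕ-injective (≡-mod⇒≡ (toℕ<n a) (toℕ<n a′)
    (≡-mod-cancelʳ (dist a t) (≡-mod-trans (a+dist≡t a t)
      (≡-mod-sym (subst (λ d → toℕ a′ + d ≡ toℕ t [mod N ]) (sym eq) (a+dist≡t a′ t))))))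

  dist-injectiveʳ : ∀ a → Injective _≡_ _≡_ (dist a)
  dist-injectiveʳ a {t} {t′} eq = toℕ-injective (≡-mod⇒≡ (toℕ<n t) (toℕ<n t′)
    (≡-mod-trans (≡-mod-sym (a+dist≡t a t))
      (subst (λ d → toℕ a + d ≡ toℕ t′ [mod N ]) (sym eq) (a+dist≡t a t′))))

  a′+[dist∸dist]≡a : ∀ {a a′ b} → dist a b ≤ dist a′ b → toℕ a′ + (dist a′ b ∸ dist a b) ≡ toℕ a [mod N ]
  a′+[dist∸dist]≡a {a} {a′} {b} a≤a′ = ≡-mod-cancelʳ (dist a b)
    (≡-mod-trans (≡⇒≡-mod (begin
      toℕ a′ + (dist a′ b ∸ dist a b) + dist a b   ≡⟨ +-assoc (toℕ a′) _ _ ⟩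
      toℕ a′ + (dist a′ b ∸ dist a b + dist a b)   ≡⟨ cong (toℕ a′ +_) (m∸n+n≡m a≤a′) ⟩
      toℕ a′ + dist a′ b                           ∎))
    (≡-mod-trans (a+dist≡t a′ b) (≡-mod-sym (a+dist≡t a b))))

enum : ∀ {m} (p : Subset m) → Fin ∣ p ∣ → Fin m
enum (inside  ∷ p) Fin.zero    = Fin.zero
enum (inside  ∷ p) (Fin.suc j) = Fin.suc (enum p j)
enum (outside ∷ p) j           = Fin.suc (enum p j)

enum-∈ : ∀ {m} (p : Subset m) j → enum p j ∈ p
enum-∈ (inside  ∷ p) Fin.zero    = here
enum-∈ (inside  ∷ p) (Fin.suc j) = there (enum-∈ p j)
enum-∈ (outside ∷ p) j           = there (enum-∈ p j)

enum-injective : ∀ {m} (p : Subset m) → Injective _≡_ _≡_ (enum p)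
enum-injective (inside  ∷ p) {Fin.zero}  {Fin.zero}   _ = refl
enum-injective (inside  ∷ p) {Fin.suc j} {Fin.suc j′} e =
  cong Fin.suc (enum-injective p (Finₚ.suc-injective e))
enum-injective (outside ∷ p) e = enum-injective p (Finₚ.suc-injective e)

bounded-injection⇒≤ : ∀ {a c} (g : Fin a → ℕ) → (∀ z → g z < c) → Injective _≡_ _≡_ g → a ≤ c
bounded-injection⇒≤ {a} {c} g g<c g-inj = injective⇒≤ G-inj
  where
  G : Fin a → Fin c
  G z = fromℕ< (g<c z)
  G-inj : Injective _≡_ _≡_ G
  G-inj {z} {z′} e =
    g-inj (trans (sym (toℕ-fromℕ< (g<c z))) (trans (cong toℕ e) (toℕ-fromℕ< (g<c z′))))

∣p∣+i≤c : ∀ {m i c} (p : Subset m) (f : Fin m → ℕ) (h : Fin i → ℕ) →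
          (∀ {t} → t ∈ p → f t < c) → (∀ j → h j < c) →
          (∀ {t t′} → t ∈ p → t′ ∈ p → f t ≡ f t′ → t ≡ t′) → Injective _≡_ _≡_ h →
          (∀ {t} j → t ∈ p → f t ≢ h j) →
          ∣ p ∣ + i ≤ c
∣p∣+i≤c {i = i} {c} p f h f<c h<c f-inj h-inj f≢h =
  bounded-injection⇒≤ (g ∘ splitAt ∣ p ∣) (g<c ∘ splitAt ∣ p ∣)
    (Injection.injective (↔⇒↣ (+↔⊎ {∣ p ∣} {i})) ∘ g-inj)
  where
  g : Fin ∣ p ∣ ⊎ Fin i → ℕ
  g = [ f ∘ enum p , h ]

  g<c : ∀ z → g z < c
  g<c (inj₁ u) = f<c (enum-∈ p u)
  g<c (inj₂ j) = h<c j

  g-inj : Injective _≡_ _≡_ g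
  g-inj {inj₁ u} {inj₁ u′} e = cong inj₁ (enum-injective p (f-inj (enum-∈ p u) (enum-∈ p u′) e))
  g-inj {inj₁ u} {inj₂ j}  e = contradiction e (f≢h j (enum-∈ p u))
  g-inj {inj₂ j} {inj₁ u}  e = contradiction (sym e) (f≢h j (enum-∈ p u))
  g-inj {inj₂ j} {inj₂ j′} e = cong inj₂ (h-inj e)

minimiser : ∀ {m} (g : Fin (suc m) → ℕ) → ∃ λ j → ∀ j′ → g j ≤ g j′
minimiser g = argmin g Fin.zero (allFin _) , λ j′ →
  All.lookup (f[argmin]≤f[xs] {f = g} Fin.zero (allFin _)) (∈-allFin j′)

module Window (N K : ℕ) (1+K<N : suc K < N) where

  instance
    N≢0 : NonZero N
    N≢0 = >-nonZero (≤-<-trans z≤n 1+K<N)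

  InWindow : Fin N → Fin N → Set
  InWindow a t = ∃ λ d → d ≤ K × toℕ a + d ≡ toℕ t [mod N ]

  inWindow⇒dist≤K : ∀ {a t} → InWindow a t → dist a t ≤ K
  inWindow⇒dist≤K (d , d≤K , a+d≡t) =
    subst (_≤ K) (sym (dist-unique (<-trans (s≤s d≤K) 1+K<N) a+d≡t)) d≤K

  -- suc K < N keeps the point suc K steps ahead of a out of the window of a.
  window-gap : ∀ {a s t} δ → toℕ a + δ ≡ toℕ s [mod N ] → InWindow a t → δ + dist s t ≢ suc K
  window-gap {a} {s} {t} δ a+δ≡s (g , g≤K , a+g≡t) δ+f≡1+K = <⇒≢ (s≤s g≤K) g≡1+K
    where
    δ+f≡g : δ + dist s t ≡ g [mod N ]
    δ+f≡g = ≡-mod-cancelˡ (toℕ a) (≡-mod-trans (≡⇒≡-mod (sym (+-assoc (toℕ a) δ _)))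
      (≡-mod-trans (≡-mod-+ʳ (dist s t) a+δ≡s) (≡-mod-trans (a+dist≡t s t) (≡-mod-sym a+g≡t))))

    g≡1+K : g ≡ suc K
    g≡1+K = sym (≡-mod⇒≡ 1+K<N (<-trans (s≤s g≤K) 1+K<N) (subst (_≡ g [mod N ]) δ+f≡1+K δ+f≡g))

  ∣p∣+m≤1+K : ∀ {m} (p : Subset N) → Nonempty p → (a : Fin (suc m) → Fin N) → Injective _≡_ _≡_ a →
              (∀ j {t} → t ∈ p → InWindow (a j) t) → ∣ p ∣ + m ≤ suc K
  ∣p∣+m≤1+K {m} p (b , b∈p) a a-inj window =
    ∣p∣+i≤c p (dist s) h dist<1+K h<1+K (λ _ _ → dist-injectiveʳ s) h-inj dist≢h
    where
    D : Fin (suc m) → ℕ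
    D j = dist (a j) b

    nearest : Fin (suc m)
    nearest = proj₁ (minimiser D)

    s : Fin N
    s = a nearest

    δ : Fin m → ℕ
    δ j = D (punchIn nearest j) ∸ D nearest

    h : Fin m → ℕ
    h j = suc K ∸ δ j

    D-nearest≤ : ∀ j → D nearest ≤ D j
    D-nearest≤ = proj₂ (minimiser D)

    0<δ : ∀ j → 0 < δ j
    0<δ j = m<n⇒0<n∸m (≤∧≢⇒< (D-nearest≤ _) (punchInᵢ≢i nearest j ∘ sym ∘ a-inj ∘ dist-injectiveˡ b))

    δ≤1+K : ∀ j → δ j ≤ suc K
    δ≤1+K j = ≤-trans (m∸n≤m _ (D nearest))
      (≤-trans (inWindow⇒dist≤K (window (punchIn nearest j) b∈p)) (n≤1+n K))

    dist<1+K : ∀ {t} → t ∈ p → dist s t < suc K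
    dist<1+K t∈p = s≤s (inWindow⇒dist≤K (window nearest t∈p))

    h<1+K : ∀ j → h j < suc K
    h<1+K j = ∸-monoʳ-< (0<δ j) (δ≤1+K j)

    h-inj : Injective _≡_ _≡_ h
    h-inj {j} {j′} hj≡hj′ = punchIn-injective nearest j j′ (a-inj (dist-injectiveˡ b (begin
      D (punchIn nearest j)   ≡⟨ m∸n+n≡m (D-nearest≤ _) ⟨
      δ j + D nearest         ≡⟨ cong (_+ D nearest) (∸-cancelˡ-≡ (δ≤1+K j) (δ≤1+K j′) hj≡hj′) ⟩
      δ j′ + D nearest        ≡⟨ m∸n+n≡m (D-nearest≤ _) ⟩
      D (punchIn nearest j′)  ∎)))
      where open ≡-Reasoning

    dist≢h : ∀ {t} j → t ∈ p → dist s t ≢ h j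
    dist≢h {t} j t∈p dist≡h =
      window-gap {a (punchIn nearest j)} {s} {t} (δ j) (a′+[dist∸dist]≡a {a = s} {b = b} (D-nearest≤ _))
        (window (punchIn nearest j) t∈p) (trans (cong (δ j +_) dist≡h) (m+[n∸m]≡n (δ≤1+K j)))

incomparable⇒inWindow : ∀ {n k i j} (1+k<N : suc k < n + k) → Incomp n k i j →
                        Window.InWindow (n + k) k 1+k<N i j
incomparable⇒inWindow _ (d , d≤k , inj₁ i+d≡j) = d , d≤k , ≡⇒≡-mod i+d≡j
incomparable⇒inWindow {n} {k} {j = j} _ (d , d≤k , inj₂ i+d≡j+N) =
  d , d≤k , 0 , 1 , trans (+-identityʳ _) (trans i+d≡j+N (cong (toℕ j +_) (sym (*-identityˡ (n + k)))))

consistent-⊆ : ∀ {m k R x} → Consistent {m} k R x → ∀ {α β} → toℕ α ≤ toℕ β → R (x β) ⊆ R (x α)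
consistent-⊆ consistent {α} {β} α≤β with α Finₚ.≟ β
... | yes refl = λ t∈R → t∈R
... | no  α≢β  = consistent α β (Finₚ.≤∧≢⇒< α≤β α≢β)

proposition3p1 : (n k : ℕ) → 3 ≤ n → (R : PairSet (n + k)) →
    MaximalReversible n k R → (x : Fin (suc k) → Fin (n + k)) →
    Labeling k R x → Consistent k R x →
    (i : Fin (suc k)) → ∣ R (x i) ∣ ≤ (k + 1) ∸ toℕ i
proposition3p1 n k 3≤n R ((R⊆Inc , _) , _) x (x-inj , _) consistent i with nonempty? (R (x i))
... | no  empty    = subst (_≤ _) (sym (trans (cong ∣_∣ (Empty-unique empty)) (∣⊥∣≡0 (n + k)))) z≤n
... | yes nonempty = m+n≤o⇒m≤o∸n _ (subst (∣ R (x i) ∣ + toℕ i ≤_) (+-comm 1 k)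
      (Window.∣p∣+m≤1+K (n + k) k 1+k<N (R (x i)) nonempty y y-inj window))
  where
  1+k<N : suc k < n + k
  1+k<N = +-monoˡ-< k (≤-trans (n≤1+n 2) 3≤n)

  y : Fin (suc (toℕ i)) → Fin (n + k)
  y j = x (inject≤ j (toℕ<n i))

  y-inj : Injective _≡_ _≡_ y
  y-inj = inject≤-injective _ _ _ _ ∘ x-inj

  window : ∀ j {t} → t ∈ R (x i) → Window.InWindow (n + k) k 1+k<N (y j) t
  window j t∈R = incomparable⇒inWindow 1+k<N (R⊆Inc _ _ (consistent-⊆ {R = R} {x} consistent j≤i t∈R))
    where
    j≤i : toℕ (inject≤ j (toℕ<n i)) ≤ toℕ i
    j≤i = subst (_≤ toℕ i) (sym (toℕ-inject≤ j _)) (s≤s⁻¹ (toℕ<n j))
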